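{- Let $(\mathbf{d^+},\mathbf{d^- })$ be a bi-degree sequence on vertices $v_1,\dots,v_n$ and let $F\subseteq\{v_1,\dots,v_{n-1}\}$ be a forbidden set, with the vertices indexed in $F$-normal order, i.e. $F=\{v_{n-|F|},\dots,v_{n-1}\}$ and for each $i=1,\dots,n-|F|-2$ either $d^-_i>d^-_{i+1}$, or $d^-_i=d^-_{i+1}$ and $d^+_i\ge d^+_{i+1}$. Let $A$ be any $d^+_n$-element subset of $\{v_1,\dots,v_{n-|F|-1}\}$ (a possible out-neighborhood of $v_n$ avoiding $F$). If the $A$-reduced bi-degree sequence $(\mathbf{d^+}|_A,\mathbf{d^- }|_A)$ is bi-graphical, then the $F[d^+_n]$-reduced bi-degree sequence $(\mathbf{d^+}|_{F[d^+_n]},\mathbf{d^- }|_{F[d^+_n]})$ is bi-graphical as well, where $F[d^+_n]=\{v_1,\dots,v_{d^+_n}\}$ is the set of the first $d^+_n$ vertices in the $F$-normal order.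
   Context: A bi-degree sequence is a pair of sequences $(\{d^+_1,\dots,d^+_n\},\{d^-_1,\dots,d^-_n\})$ of nonnegative integers; it is bi-graphical if there is a simple directed graph on $v_1,\dots,v_n$ (no loops, no parallel edges in the same direction; opposite edges $uv$, $vu$ allowed) where $v_j$ has out-degree $d^+_j$ and in-degree $d^-_j$; sequences with a negative entry are not bi-graphical. For a $d^+_n$-element subset $A\subseteq\{v_1,\dots,v_{n-1}\}$, the $A$-reduced sequence is defined by $d^+_k|_A=d^+_k$ for $k\ne n$, $d^+_n|_A=0$, and $d^-_k|_A=d^-_k-1$ if $v_k\in A$, $d^-_k|_A=d^-_k$ otherwise; any index $k$ with $d^+_k|_A=d^-_k|_A=0$ is removed. -}

module Defs where

open import Data.Bool using (Bool; true; false; if_then_else_; _∧_)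
open import Data.Nat using (ℕ; zero; suc; _<ᵇ_; _≡ᵇ_)
open import Data.Integer using (ℤ; +_; _-_)
open import Data.Fin using (Fin; toℕ; fromℕ)
open import Data.List using (List; []; _∷_; length; lookup; map; allFin)
open import Data.Nat.ListAction using (sum)
open import Data.Product using (Σ; _×_; _,_; proj₁; proj₂)
open import Relation.Binary.PropositionalEquality using (_≡_)

-- A (possibly non-valid) bi-degree sequence after reduction: list of
-- (out-degree, in-degree) pairs, integers since a reduction may create -1.
BiSeq : Set
BiSeq = List (ℤ × ℤ)

ind : Bool → ℕ
ind true  = 1
ind false = 0

outdeg : ∀ {k} → (Fin k → Fin k → Bool) → Fin k → ℕ
outdeg {k} E i = sum (map (λ j → ind (E i j)) (allFin k))

indeg : ∀ {k} → (Fin k → Fin k → Bool) → Fin k → ℕ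
indeg {k} E j = sum (map (λ i → ind (E i j)) (allFin k))

-- bi-graphical: there is a loopless digraph (no parallel edges in the same
-- direction automatically, opposite edges allowed) realising the sequence;
-- negative entries can never be realised since they must equal (+ degree).
BiGraphical : BiSeq → Set
BiGraphical l =
  Σ (Fin (length l) → Fin (length l) → Bool) λ E →
    ((i : Fin (length l)) → E i i ≡ false) ×
    ((i : Fin (length l)) →
       (proj₁ (lookup l i) ≡ + outdeg E i) × (proj₂ (lookup l i) ≡ + indeg E i))

isZeroPair : ℤ × ℤ → Bool
isZeroPair (+ 0 , + 0) = true
isZeroPair _           = false

dropZeros : BiSeq → BiSeq
dropZeros [] = []
dropZeros (x ∷ xs) = if isZeroPair x then dropZeros xs else x ∷ dropZeros xs

-- The A-reduced sequence on vertices v_1..v_n = Fin (suc m) (v_n = fromℕ m),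
-- where the set A ⊆ {v_1..v_{n-1}} is given by its characteristic function.
reduced : ∀ {m} → (Fin (suc m) → ℕ) → (Fin (suc m) → ℕ) → (Fin (suc m) → Bool) → BiSeq
reduced {m} d⁺ d⁻ A = dropZeros (map entry (allFin (suc m)))
  where
  entry : Fin (suc m) → ℤ × ℤ
  entry k = (if toℕ k ≡ᵇ m then + 0 else + d⁺ k)
          , (if A k then + d⁻ k - + 1 else + d⁻ k)

firstSet : ∀ {m} → ℕ → Fin (suc m) → Bool
firstSet d k = toℕ k <ᵇ d

module Submission where

-- After unfolding, a reduced sequence is bi-graphical iff some loopless
-- digraph on all n vertices realizes its entries (vertices of degree (0,0), deleted
-- by Defs.reduced, may be added or removed as isolated vertices).
--   The core is a switching lemma: if inn(i) > inn(j), and either inn(i) ≥ inn(j) + 2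
-- or out(j) ≤ out(i), then redirecting one or two edges moves one unit of in-degree
-- from i to j, keeping out-degrees and looplessness.  Hence a realization for B yields
-- one for B with j ∈ B exchanged for i ∉ B, whenever i precedes j in normal order.
--   Starting from B = A, repeatedly exchange some j ∈ B ∖ F[d] for some i ∈ F[d] ∖ B;
-- since i < d ≤ j < n - |F| - 1, the normal order gives i ⊒ j.  Each exchange shrinks
-- |B ∖ F[d]| by one, so induction on it reaches B = F[d].

open import Defs
open import Data.Nat using (ℕ; suc; _≤_; _<_; _≥_; _>_; _∸_)
open import Data.Fin using (Fin; toℕ; fromℕ)
open import Data.Fin.Subset using (Subset; ∣_∣; _∈_)
open import Data.Vec using (lookup)
open import Data.Sum using (_⊎_)
open import Data.Product using (_×_)
open import Relation.Binary.PropositionalEquality using (_≡_)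

open import Data.Bool using (Bool; true; false; if_then_else_; not; _∧_)
open import Data.Bool.Properties using (not-¬; T-≡)
open import Data.Empty using (⊥-elim)
open import Data.Fin using (zero; suc; _≟_; cast; fromℕ<)
open import Data.Fin.Properties using (cast-is-id; toℕ<n; toℕ-fromℕ<)
open import Data.Integer using (ℤ)
import Data.Integer as Int
open import Data.Integer.Properties using () renaming (+-injective to +ℤ-injective)
open import Data.List using ([]; _∷_; length; map; allFin; tabulate) renaming (lookup to entryAt)
open import Data.List.Properties using (map-tabulate; lookup-tabulate; length-tabulate)
open import Data.Maybe using (Maybe; just; nothing; maybe′)
import Data.Maybe as Maybe
open import Data.Nat using (zero; _+_; z≤n; s≤s; s≤s⁻¹; _<ᵇ_; _≡ᵇ_)
open import Data.Nat.ListAction using (sum)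
open import Data.Nat.Properties
  using ( +-0-commutativeMonoid; +-commutativeSemigroup; +-assoc; +-comm; +-identityʳ; +-suc
        ; +-cancelˡ-≡; +-cancelʳ-≡; suc-injective; ≤-trans; ≤-reflexive; <-trans; <-≤-trans
        ; <⇒≤; <⇒≢; ≮⇒≥; 1+n≰n; n<1+n; m≤n⇒m≤1+n; m∸n≤m; m∸n+n≡m
        ; ≡ᵇ⇒≡; <ᵇ⇒<; <⇒<ᵇ)
open import Data.Nat.Tactic.RingSolver using (solve-∀)
open import Algebra.Properties.CommutativeMonoid.Sum +-0-commutativeMonoid
  using (∑-distrib-+; sum-cong-≗; sum-replicate-zero) renaming (sum to ∑)
open import Algebra.Properties.CommutativeSemigroup +-commutativeSemigroup
  using (x∙yz≈y∙xz)
import Data.Product as Product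
open import Data.Product using (Σ; ∃-syntax; _,_; proj₁; proj₂)
open import Data.Sum using (inj₁; inj₂)
import Data.Sum as Sum
open import Data.Vec using ([]; _∷_)
open import Data.Vec.Functional using (Vector; updateAt)
open import Data.Vec.Functional.Properties using (updateAt-updates; updateAt-minimal)
open import Data.Vec.Properties using (lookup⇒[]=)
open import Function.Base using (id; const; _∘_)
open import Function.Bundles using (_⇔_; mk⇔; Equivalence)
open import Function.Construct.Composition using (_⇔-∘_)
open import Relation.Nullary using (yes; no)
open import Relation.Binary.PropositionalEquality
  using (_≢_; refl; sym; trans; cong; cong₂; subst; subst₂; module ≡-Reasoning)

count : ∀ {n} → (Fin n → Bool) → ℕ
count p = ∑ (λ k → ind (p k))

count-cong : ∀ {n} {p q : Fin n → Bool} → (∀ k → p k ≡ q k) → count p ≡ count q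
count-cong p≗q = sum-cong-≗ (λ k → cong ind (p≗q k))

count-empty : ∀ n → count {n} (λ _ → false) ≡ 0
count-empty n = sum-replicate-zero n

count≤size : ∀ {n} (p : Fin n → Bool) → count p ≤ n
count≤size {zero}  p = z≤n
count≤size {suc n} p with p zero
... | true  = s≤s (count≤size (p ∘ suc))
... | false = m≤n⇒m≤1+n (count≤size (p ∘ suc))

count≡0⇒empty : ∀ {n} (p : Fin n → Bool) → count p ≡ 0 → ∀ k → p k ≡ false
count≡0⇒empty {suc n} p eq k with p zero in p₀
count≡0⇒empty {suc n} p eq zero    | false = p₀
count≡0⇒empty {suc n} p eq (suc k) | false = count≡0⇒empty (p ∘ suc) eq k
count≡0⇒empty {suc n} p () k       | true

pigeonhole : ∀ {n} (p q : Fin n → Bool) → count q < count p →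
             ∃[ k ] p k ≡ true × q k ≡ false
pigeonhole {suc n} p q lt with p zero in p₀ | q zero in q₀
... | true  | false = zero , p₀ , q₀
... | true  | true  = Product.map suc id (pigeonhole (p ∘ suc) (q ∘ suc) (s≤s⁻¹ lt))
... | false | false = Product.map suc id (pigeonhole (p ∘ suc) (q ∘ suc) lt)
... | false | true  = Product.map suc id (pigeonhole (p ∘ suc) (q ∘ suc) (<-trans (n<1+n _) lt))

count>0⇒element : ∀ {n} (p : Fin n → Bool) → 0 < count p → ∃[ k ] p k ≡ true
count>0⇒element {n} p pos =
  Product.map₂ proj₁ (pigeonhole p (const false) (subst (_< count p) (sym (count-empty n)) pos))

infixl 6 _[_≔_]
_[_≔_] : ∀ {n} {A : Set} → Vector A n → Fin n → A → Vector A n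
xs [ i ≔ c ] = updateAt xs i (const c)

update-here : ∀ {n} {A : Set} (xs : Vector A n) (i : Fin n) {c : A} → (xs [ i ≔ c ]) i ≡ c
update-here xs i = updateAt-updates i xs

update-there : ∀ {n} {A : Set} (xs : Vector A n) {i k : Fin n} {c : A} → k ≢ i → (xs [ i ≔ c ]) k ≡ xs k
update-there xs {i} {k} k≢i = updateAt-minimal k i xs k≢i

count-update : ∀ {n} (p : Fin n → Bool) (b : Fin n) (c : Bool) →
               count (p [ b ≔ c ]) + ind (p b) ≡ count p + ind c
count-update {suc n} p zero c = begin
  ind c + count (p ∘ suc) + ind (p zero)   ≡⟨ +-assoc (ind c) _ _ ⟩
  ind c + (count (p ∘ suc) + ind (p zero)) ≡⟨ cong (ind c +_) (+-comm _ (ind (p zero))) ⟩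
  ind c + count p                          ≡⟨ +-comm (ind c) _ ⟩
  count p + ind c                          ∎
  where open ≡-Reasoning
count-update {suc n} p (suc b) c = begin
  ind (p zero) + count ((p ∘ suc) [ b ≔ c ]) + ind (p (suc b))
    ≡⟨ +-assoc (ind (p zero)) _ _ ⟩
  ind (p zero) + (count ((p ∘ suc) [ b ≔ c ]) + ind (p (suc b)))
    ≡⟨ cong (ind (p zero) +_) (count-update (p ∘ suc) b c) ⟩
  ind (p zero) + (count (p ∘ suc) + ind c)
    ≡⟨ +-assoc (ind (p zero)) _ _ ⟨
  count p + ind c
    ∎
  where open ≡-Reasoning

count-insert : ∀ {n} (p : Fin n → Bool) (b : Fin n) → p b ≡ false →
               count (p [ b ≔ true ]) ≡ suc (count p)
count-insert p b pb = begin
  count (p [ b ≔ true ])                ≡⟨ +-identityʳ _ ⟨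
  count (p [ b ≔ true ]) + ind false    ≡⟨ cong (λ x → count (p [ b ≔ true ]) + ind x) pb ⟨
  count (p [ b ≔ true ]) + ind (p b)    ≡⟨ count-update p b true ⟩
  count p + 1                           ≡⟨ +-comm (count p) 1 ⟩
  suc (count p)                         ∎
  where open ≡-Reasoning

count-initial : ∀ n d → d ≤ n → count {n} (λ k → toℕ k <ᵇ d) ≡ d
count-initial zero    zero    _       = refl
count-initial (suc n) zero    _       = count-empty n
count-initial (suc n) (suc d) (s≤s d≤n) = cong suc (count-initial n d d≤n)

_∖_ : ∀ {n} → (Fin n → Bool) → (Fin n → Bool) → Fin n → Bool
(p ∖ q) k = p k ∧ not (q k)

∖-member : ∀ {n} (p q : Fin n → Bool) {k} → (p ∖ q) k ≡ true → p k ≡ true × q k ≡ false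
∖-member p q {k} eq with p k | q k
∖-member p q refl | true | false = refl , refl

∖-empty⇒≡ : ∀ {n} (p q : Fin n → Bool) {k} → (p ∖ q) k ≡ false → (q ∖ p) k ≡ false → p k ≡ q k
∖-empty⇒≡ p q {k} pq qp with p k | q k
∖-empty⇒≡ p q refl refl | false | false = refl
∖-empty⇒≡ p q refl refl | true  | true  = refl

count-∖-balance : ∀ {n} (p q : Fin n → Bool) → count p ≡ count q →
                  count (p ∖ q) ≡ count (q ∖ p)
count-∖-balance {n} p q |p|≡|q| = +-cancelˡ-≡ (count q) _ _ (begin
  count q + count (p ∖ q)                     ≡⟨ ∑-distrib-+ {n} _ _ ⟨
  ∑ (λ k → ind (q k) + ind ((p ∖ q) k))       ≡⟨ sum-cong-≗ (λ k → pointwise (p k) (q k)) ⟩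
  ∑ (λ k → ind (p k) + ind ((q ∖ p) k))       ≡⟨ ∑-distrib-+ {n} _ _ ⟩
  count p + count (q ∖ p)                     ≡⟨ cong (_+ count (q ∖ p)) |p|≡|q| ⟩
  count q + count (q ∖ p)                     ∎)
  where
  open ≡-Reasoning
  pointwise : ∀ a b → ind b + ind (a ∧ not b) ≡ ind a + ind (b ∧ not a)
  pointwise false false = refl
  pointwise false true  = refl
  pointwise true  false = refl
  pointwise true  true  = refl

δ : ∀ {n} → Fin n → Fin n → ℕ
δ i = const 0 [ i ≔ 1 ]

exchange : ∀ {n} → (Fin n → Bool) → Fin n → Fin n → Fin n → Bool
exchange B i j = B [ i ≔ true ] [ j ≔ false ]

module _ {n} (B : Fin n → Bool) {i j : Fin n} (Bi : B i ≡ false) (Bj : B j ≡ true) where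

  private
    j≢i : j ≢ i
    j≢i refl = not-¬ Bj Bi

  exchange-balance : ∀ k → δ j k + ind (exchange B i j k) ≡ δ i k + ind (B k)
  exchange-balance k with k ≟ j
  ... | yes refl = trans (cong₂ _+_ (update-here (const 0) k) (cong ind (update-here (B [ i ≔ true ]) k)))
                         (sym (cong₂ _+_ (update-there (const 0) j≢i) (cong ind Bj)))
  ... | no k≢j with k ≟ i
  ...   | yes refl = trans (cong₂ _+_ (update-there (const 0) k≢j)
                                      (cong ind (trans (update-there _ k≢j) (update-here B k))))
                           (sym (cong₂ _+_ (update-here (const 0) k) (cong ind Bi)))
  ...   | no k≢i = cong₂ _+_ (trans (update-there (const 0) k≢j) (sym (update-there (const 0) k≢i)))
                             (cong ind (trans (update-there _ k≢j) (update-there B k≢i)))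

  exchange-bounded : (P : Fin n → Set) → P i → (∀ k → B k ≡ true → P k) →
                     ∀ k → exchange B i j k ≡ true → P k
  exchange-bounded P Pi PB k eq with k ≟ j
  ... | yes refl = ⊥-elim (not-¬ eq (update-here (B [ i ≔ true ]) k))
  ... | no k≢j with k ≟ i
  ...   | yes refl = Pi
  ...   | no k≢i = PB k (trans (sym (trans (update-there _ k≢j) (update-there B k≢i))) eq)

  exchange-count : count (exchange B i j) ≡ count B
  exchange-count = +-cancelʳ-≡ 1 _ _ (begin
    count (exchange B i j) + 1
      ≡⟨ cong (λ b → count (exchange B i j) + ind b) (trans (update-there B j≢i) Bj) ⟨
    count (exchange B i j) + ind ((B [ i ≔ true ]) j)
      ≡⟨ count-update (B [ i ≔ true ]) j false ⟩
    count (B [ i ≔ true ]) + 0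
      ≡⟨ cong (λ b → count (B [ i ≔ true ]) + ind b) Bi ⟨
    count (B [ i ≔ true ]) + ind (B i)
      ≡⟨ count-update B i true ⟩
    count B + 1
      ∎)
    where open ≡-Reasoning

  exchange-mismatch : (F : Fin n → Bool) → F i ≡ true → F j ≡ false →
                      count (exchange B i j ∖ F) + 1 ≡ count (B ∖ F)
  exchange-mismatch F Fi Fj = begin
    count (exchange B i j ∖ F) + 1
      ≡⟨ cong (_+ 1) (count-cong pointwise) ⟩
    count ((B ∖ F) [ j ≔ false ]) + 1
      ≡⟨ cong (λ b → count ((B ∖ F) [ j ≔ false ]) + ind b) BFj ⟨
    count ((B ∖ F) [ j ≔ false ]) + ind ((B ∖ F) j)
      ≡⟨ count-update (B ∖ F) j false ⟩
    count (B ∖ F) + 0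
      ≡⟨ +-identityʳ _ ⟩
    count (B ∖ F)
      ∎
    where
    open ≡-Reasoning
    BFj : (B ∖ F) j ≡ true
    BFj = cong₂ (λ b c → b ∧ not c) Bj Fj
    pointwise : ∀ k → (exchange B i j ∖ F) k ≡ ((B ∖ F) [ j ≔ false ]) k
    pointwise k with k ≟ j
    ... | yes refl = trans (cong (λ b → b ∧ not (F k)) (update-here (B [ i ≔ true ]) k))
                           (sym (update-here (B ∖ F) k))
    ... | no k≢j with k ≟ i
    ...   | yes refl = begin
      exchange B k j k ∧ not (F k)       ≡⟨ cong (λ b → b ∧ not (F k))
                                               (trans (update-there _ k≢j) (update-here B k)) ⟩
      not (F k)                          ≡⟨ cong not Fi ⟩
      false                              ≡⟨ cong (λ b → b ∧ not (F k)) Bi ⟨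
      (B ∖ F) k                          ≡⟨ update-there (B ∖ F) k≢j ⟨
      ((B ∖ F) [ j ≔ false ]) k          ∎
    ...   | no k≢i = trans (cong (λ b → b ∧ not (F k)) (trans (update-there _ k≢j) (update-there B k≢i)))
                           (sym (update-there (B ∖ F) k≢j))

Digraph : ℕ → Set
Digraph n = Fin n → Fin n → Bool

out : ∀ {n} → Digraph n → Fin n → ℕ
out E v = count (E v)

inn : ∀ {n} → Digraph n → Fin n → ℕ
inn E v = count (λ u → E u v)

Loopless : ∀ {n} → Digraph n → Set
Loopless E = ∀ v → E v v ≡ false

degrees : ∀ {n} → Digraph n → Fin n → ℤ × ℤ
degrees E v = Int.+ out E v , Int.+ inn E v

Realizable : ∀ {n} → (Fin n → ℤ × ℤ) → Set
Realizable {n} D = Σ (Digraph n) λ E → Loopless E × (∀ v → D v ≡ degrees E v)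

realizable-cong : ∀ {n} {D D′ : Fin n → ℤ × ℤ} → (∀ v → D v ≡ D′ v) →
                  Realizable D → Realizable D′
realizable-cong D≗D′ (E , loopless , realizes) =
  E , loopless , λ v → trans (sym (D≗D′ v)) (realizes v)

sum-allFin : ∀ {n} (f : Fin n → ℕ) → sum (map f (allFin n)) ≡ ∑ f
sum-allFin f = trans (cong sum (map-tabulate id f)) (sum-tabulate f)
  where
  sum-tabulate : ∀ {n} (f : Fin n → ℕ) → sum (tabulate f) ≡ ∑ f
  sum-tabulate {zero}  f = refl
  sum-tabulate {suc n} f = cong (f zero +_) (sum-tabulate (f ∘ suc))

biGraphical⇔realizable : (l : BiSeq) → BiGraphical l ⇔ Realizable (entryAt l)
biGraphical⇔realizable l = mk⇔
  (λ (E , loopless , realizes) → E , loopless , λ v →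
     cong₂ _,_ (trans (proj₁ (realizes v)) (cong (λ n → Int.+ n) (outdeg≡out E v)))
               (trans (proj₂ (realizes v)) (cong (λ n → Int.+ n) (indeg≡inn E v))))
  (λ (E , loopless , realizes) → E , loopless , λ v →
     trans (cong proj₁ (realizes v)) (cong (λ n → Int.+ n) (sym (outdeg≡out E v))) ,
     trans (cong proj₂ (realizes v)) (cong (λ n → Int.+ n) (sym (indeg≡inn E v))))
  where
  outdeg≡out : (E : Digraph (length l)) (v : Fin (length l)) → outdeg E v ≡ out E v
  outdeg≡out E v = sum-allFin (λ w → ind (E v w))
  indeg≡inn : (E : Digraph (length l)) (v : Fin (length l)) → indeg E v ≡ inn E v
  indeg≡inn E v = sum-allFin (λ u → ind (E u v))

realizable-cast : ∀ {n n′} (e : n ≡ n′) (D : Fin n → ℤ × ℤ) (D′ : Fin n′ → ℤ × ℤ) →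
                  (∀ v → D (cast (sym e) v) ≡ D′ v) → Realizable D ⇔ Realizable D′
realizable-cast refl D D′ agree = mk⇔ (realizable-cong D≗D′) (realizable-cong (sym ∘ D≗D′))
  where
  D≗D′ : ∀ v → D v ≡ D′ v
  D≗D′ v = trans (cong D (sym (cast-is-id refl v))) (agree v)

tabulate-realizable : ∀ {n} (D : Fin n → ℤ × ℤ) → Realizable (entryAt (tabulate D)) ⇔ Realizable D
tabulate-realizable D = realizable-cast (length-tabulate D) (entryAt (tabulate D)) D (lookup-tabulate D)

-- Vertices of degree (0,0) can be added or deleted freely, as isolated vertices.

data _≼_ : BiSeq → BiSeq → Set where
  []   : [] ≼ []
  keep : ∀ x {l l′} → l ≼ l′ → (x ∷ l) ≼ (x ∷ l′)
  skip : ∀ {x l l′} → isZeroPair x ≡ true → l ≼ l′ → l ≼ (x ∷ l′)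

dropZeros-≼ : ∀ l → dropZeros l ≼ l
dropZeros-≼ []      = []
dropZeros-≼ (x ∷ l) with isZeroPair x in x-zero
... | true  = skip x-zero (dropZeros-≼ l)
... | false = keep x (dropZeros-≼ l)

isZeroPair-sound : ∀ x → isZeroPair x ≡ true → x ≡ (Int.+ 0 , Int.+ 0)
isZeroPair-sound (Int.+ zero , Int.+ zero) _ = refl

private variable
  l l′ : BiSeq

embed : l ≼ l′ → Fin (length l) → Fin (length l′)
embed (keep x s) zero    = zero
embed (keep x s) (suc a) = suc (embed s a)
embed (skip _ s) a       = suc (embed s a)

preimage : l ≼ l′ → Fin (length l′) → Maybe (Fin (length l))
preimage (keep x s) zero    = just zero
preimage (keep x s) (suc v) = Maybe.map suc (preimage s v)
preimage (skip _ s) zero    = nothing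
preimage (skip _ s) (suc v) = preimage s v

entry-embed : (s : l ≼ l′) (a : Fin (length l)) → entryAt l′ (embed s a) ≡ entryAt l a
entry-embed (keep x s) zero    = refl
entry-embed (keep x s) (suc a) = entry-embed s a
entry-embed (skip _ s) a       = entry-embed s a

entry-preimage : (s : l ≼ l′) (v : Fin (length l′)) {a : Fin (length l)} →
                 preimage s v ≡ just a → entryAt l′ v ≡ entryAt l a
entry-preimage (keep x s) zero    refl = refl
entry-preimage (keep x s) (suc v) eq with preimage s v in eq′
entry-preimage (keep x s) (suc v) refl | just b = entry-preimage s v eq′
entry-preimage (skip _ s) (suc v) eq = entry-preimage s v eq

entry-deleted : (s : l ≼ l′) (v : Fin (length l′)) →
                preimage s v ≡ nothing → entryAt l′ v ≡ (Int.+ 0 , Int.+ 0)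
entry-deleted (keep x s) (suc v) eq with preimage s v in eq′
... | nothing = entry-deleted s v eq′
entry-deleted (skip x-zero s) zero    eq = isZeroPair-sound _ x-zero
entry-deleted (skip _ s)      (suc v) eq = entry-deleted s v eq

extend : l ≼ l′ → (Fin (length l) → Bool) → Fin (length l′) → Bool
extend s p v = maybe′ p false (preimage s v)

count-extend : (s : l ≼ l′) (p : Fin (length l) → Bool) → count (extend s p) ≡ count p
count-extend [] p = refl
count-extend (keep x s) p = cong (ind (p zero) +_) (trans (count-cong pointwise) (count-extend s (p ∘ suc)))
  where
  pointwise : ∀ v → extend (keep x s) p (suc v) ≡ extend s (p ∘ suc) v
  pointwise v with preimage s v
  ... | just a  = refl
  ... | nothing = refl
count-extend (skip _ s) p = count-extend s p

count-restrict : (s : l ≼ l′) (p : Fin (length l′) → Bool) →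
                 (∀ v → preimage s v ≡ nothing → p v ≡ false) → count p ≡ count (p ∘ embed s)
count-restrict [] p avoids = refl
count-restrict (keep x s) p avoids =
  cong (ind (p zero) +_) (count-restrict s (p ∘ suc) λ v eq → avoids (suc v) (cong (Maybe.map suc) eq))
count-restrict (skip _ s) p avoids =
  trans (cong (λ b → ind b + count (p ∘ suc)) (avoids zero refl))
        (count-restrict s (p ∘ suc) (avoids ∘ suc))

isolated : ∀ {n} (E : Digraph n) (v : Fin n) → (Int.+ 0 , Int.+ 0) ≡ degrees E v →
           out E v ≡ 0 × inn E v ≡ 0
isolated E v zero≡degrees = sym (+ℤ-injective (cong proj₁ zero≡degrees)) ,
                            sym (+ℤ-injective (cong proj₂ zero≡degrees))

realizable-extend : (s : l ≼ l′) → Realizable (entryAt l) → Realizable (entryAt l′)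
realizable-extend {l} {l′} s (E , loopless , realizes) = E′ , loopless′ , realizes′
  where
  E′ : Digraph (length l′)
  E′ u v = extend s (λ a → extend s (E a) v) u

  loopless′ : Loopless E′
  loopless′ v with preimage s v
  ... | just a  = loopless a
  ... | nothing = refl

  -- Once preimage s v is known, the row and column of v in E′ are extensions of those in E.
  realizes′ : ∀ v → entryAt l′ v ≡ degrees E′ v
  realizes′ v with preimage s v in eq
  ... | just a = begin
    entryAt l′ v  ≡⟨ entry-preimage s v eq ⟩
    entryAt l a   ≡⟨ realizes a ⟩
    degrees E a   ≡⟨ cong₂ (λ o i → Int.+ o , Int.+ i) (count-extend s (E a)) (count-extend s (λ b → E b a)) ⟨
    (Int.+ count (extend s (E a)) , Int.+ count (extend s (λ b → E b a)))  ∎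
    where open ≡-Reasoning
  ... | nothing = begin
    entryAt l′ v         ≡⟨ entry-deleted s v eq ⟩
    (Int.+ 0 , Int.+ 0)  ≡⟨ cong₂ (λ o i → Int.+ o , Int.+ i)
                                  (count-empty (length l′))
                                  (trans (count-extend s (λ _ → false)) (count-empty (length l))) ⟨
    (Int.+ count {length l′} (λ _ → false) , Int.+ count (extend s (λ _ → false)))  ∎
    where open ≡-Reasoning

realizable-restrict : (s : l ≼ l′) → Realizable (entryAt l′) → Realizable (entryAt l)
realizable-restrict {l} {l′} s (E , loopless , realizes) = E′ , loopless ∘ embed s , realizes′
  where
  E′ : Digraph (length l)
  E′ a b = E (embed s a) (embed s b)

  no-edge-into : ∀ u v → preimage s v ≡ nothing → E u v ≡ false
  no-edge-into u v eq = count≡0⇒empty (λ w → E w v)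
    (proj₂ (isolated E v (trans (sym (entry-deleted s v eq)) (realizes v)))) u

  no-edge-from : ∀ u v → preimage s v ≡ nothing → E v u ≡ false
  no-edge-from u v eq = count≡0⇒empty (E v)
    (proj₁ (isolated E v (trans (sym (entry-deleted s v eq)) (realizes v)))) u

  realizes′ : ∀ a → entryAt l a ≡ degrees E′ a
  realizes′ a = begin
    entryAt l a              ≡⟨ entry-embed s a ⟨
    entryAt l′ (embed s a)   ≡⟨ realizes (embed s a) ⟩
    degrees E (embed s a)    ≡⟨ cong₂ (λ o i → Int.+ o , Int.+ i)
                                  (count-restrict s (E (embed s a)) (no-edge-into (embed s a)))
                                  (count-restrict s (λ u → E u (embed s a)) (no-edge-from (embed s a))) ⟩
    degrees E′ a             ∎
    where open ≡-Reasoning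

dropZeros-realizable : ∀ l → Realizable (entryAt (dropZeros l)) ⇔ Realizable (entryAt l)
dropZeros-realizable l = mk⇔ (realizable-extend (dropZeros-≼ l)) (realizable-restrict (dropZeros-≼ l))

balance : ∀ {a b c d x y : ℕ} → x + a ≡ y + b → b + c ≡ a + d → c + x ≡ d + y
balance {a} {b} {c} {d} {x} {y} h₁ h₂ = +-cancelˡ-≡ (a + b) _ _ (begin
  a + b + (c + x)    ≡⟨ rearrange a b c x ⟩
  x + a + (b + c)    ≡⟨ cong₂ _+_ h₁ h₂ ⟩
  y + b + (a + d)    ≡⟨ rearrange b a d y ⟨
  b + a + (d + y)    ≡⟨ cong (_+ (d + y)) (+-comm b a) ⟩
  a + b + (d + y)    ∎)
  where
  open ≡-Reasoning
  rearrange : ∀ a b c x → a + b + (c + x) ≡ x + a + (b + c)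
  rearrange = solve-∀

InShift : ∀ {n} → Digraph n → Digraph n → Fin n → Fin n → Set
InShift E E′ i j = (∀ x → out E′ x ≡ out E x) × (∀ x → δ i x + inn E′ x ≡ δ j x + inn E x)

InShift-trans : ∀ {n} {E E₁ E₂ : Digraph n} {i w j} →
                InShift E E₁ i w → InShift E₁ E₂ w j → InShift E E₂ i j
InShift-trans {E = E} {E₁} {E₂} {i} {w} {j} (out₁ , in₁) (out₂ , in₂) =
  (λ x → trans (out₂ x) (out₁ x)) ,
  (λ x → +-cancelˡ-≡ (δ w x) _ _ (begin
    δ w x + (δ i x + inn E₂ x)   ≡⟨ x∙yz≈y∙xz (δ w x) (δ i x) (inn E₂ x) ⟩
    δ i x + (δ w x + inn E₂ x)   ≡⟨ cong (δ i x +_) (in₂ x) ⟩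
    δ i x + (δ j x + inn E₁ x)   ≡⟨ x∙yz≈y∙xz (δ i x) (δ j x) (inn E₁ x) ⟩
    δ j x + (δ i x + inn E₁ x)   ≡⟨ cong (δ j x +_) (in₁ x) ⟩
    δ j x + (δ w x + inn E x)    ≡⟨ x∙yz≈y∙xz (δ j x) (δ w x) (inn E x) ⟩
    δ w x + (δ j x + inn E x)    ∎))
  where open ≡-Reasoning

redirect : ∀ {n} → Digraph n → Fin n → Fin n → Fin n → Digraph n
redirect E u i j = E [ u ≔ E u [ i ≔ false ] [ j ≔ true ] ]

redirect-loopless : ∀ {n} {E : Digraph n} {u i j} → Loopless E → u ≢ j → Loopless (redirect E u i j)
redirect-loopless {E = E} {u} {i} {j} loopless u≢j v with v ≟ u
... | no v≢u = trans (cong (λ row → row v) (update-there E v≢u)) (loopless v)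
... | yes refl with v ≟ i
...   | yes refl = begin
  redirect E v v j v v                    ≡⟨ cong (λ row → row v) (update-here E v) ⟩
  (E v [ v ≔ false ] [ j ≔ true ]) v     ≡⟨ update-there (E v [ v ≔ false ]) u≢j ⟩
  (E v [ v ≔ false ]) v                  ≡⟨ update-here (E v) v ⟩
  false                                   ∎
  where open ≡-Reasoning
...   | no v≢i = begin
  redirect E v i j v v                    ≡⟨ cong (λ row → row v) (update-here E v) ⟩
  (E v [ i ≔ false ] [ j ≔ true ]) v     ≡⟨ update-there (E v [ i ≔ false ]) u≢j ⟩
  (E v [ i ≔ false ]) v                  ≡⟨ update-there (E v) v≢i ⟩
  E v v                                   ≡⟨ loopless v ⟩
  false                                   ∎
  where open ≡-Reasoning

redirect-shift : ∀ {n} (E : Digraph n) {u i j} → E u i ≡ true → E u j ≡ false →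
                 InShift E (redirect E u i j) i j
redirect-shift {n} E {u} {i} {j} ui uj = outs , ins
  where
  open ≡-Reasoning
  j≢i : j ≢ i
  j≢i refl with () ← trans (sym ui) uj

  row′ row : Fin n → Bool
  row′ = E u [ i ≔ false ]
  row  = row′ [ j ≔ true ]

  row-count : count row ≡ count (E u)
  row-count = begin
    count row                 ≡⟨ +-identityʳ _ ⟨
    count row + ind false     ≡⟨ cong (λ b → count row + ind b) (trans (update-there (E u) j≢i) uj) ⟨
    count row + ind (row′ j)  ≡⟨ count-update row′ j true ⟩
    count row′ + 1            ≡⟨ cong (λ b → count row′ + ind b) ui ⟨
    count row′ + ind (E u i)  ≡⟨ count-update (E u) i false ⟩
    count (E u) + 0           ≡⟨ +-identityʳ _ ⟩
    count (E u)               ∎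

  outs : ∀ x → out (redirect E u i j) x ≡ out E x
  outs x with x ≟ u
  ... | yes refl = trans (cong count (update-here E x)) row-count
  ... | no x≢u   = cong count (update-there E x≢u)

  -- Only the row of u changes, so each column changes in the entry of u only.
  column : ∀ x v → redirect E u i j v x ≡ ((λ w → E w x) [ u ≔ row x ]) v
  column x v with v ≟ u
  ... | yes refl = trans (cong (λ r → r x) (update-here E v)) (sym (update-here _ v))
  ... | no v≢u   = trans (cong (λ r → r x) (update-there E v≢u)) (sym (update-there _ v≢u))

  row-balance : ∀ x → ind (row x) + δ i x ≡ ind (E u x) + δ j x
  row-balance x with x ≟ j
  ... | yes refl = begin
    ind (row x) + δ i x      ≡⟨ cong₂ _+_ (cong ind (update-here row′ x)) (update-there (const 0) j≢i) ⟩
    1 + 0                    ≡⟨ cong₂ _+_ (cong ind uj) (update-here (const 0) x) ⟨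
    ind (E u x) + δ x x      ∎
  ... | no x≢j with x ≟ i
  ...   | yes refl = begin
    ind (row x) + δ x x      ≡⟨ cong₂ _+_ (cong ind (trans (update-there row′ x≢j) (update-here (E u) x)))
                                          (update-here (const 0) x) ⟩
    0 + 1                    ≡⟨ cong₂ _+_ (cong ind ui) (update-there (const 0) x≢j) ⟨
    ind (E u x) + δ j x      ∎
  ...   | no x≢i = cong₂ _+_ (cong ind (trans (update-there row′ x≢j) (update-there (E u) x≢i)))
                             (trans (update-there (const 0) x≢i) (sym (update-there (const 0) x≢j)))

  ins : ∀ x → δ i x + inn (redirect E u i j) x ≡ δ j x + inn E x
  ins x = balance {c = δ i x} {d = δ j x} column-count (row-balance x)
    where
    column-count : inn (redirect E u i j) x + ind (E u x) ≡ inn E x + ind (row x)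
    column-count = trans (cong (_+ ind (E u x)) (count-cong (column x)))
                         (count-update (λ w → E w x) u (row x))

insert-member : ∀ {n} (p : Fin n → Bool) {b u} → (p [ b ≔ true ]) u ≡ true → u ≢ b → p u ≡ true
insert-member p eq u≢b = trans (sym (update-there p u≢b)) eq

insert-nonmember : ∀ {n} (p : Fin n → Bool) {b u} → (p [ b ≔ true ]) u ≡ false → u ≢ b × p u ≡ false
insert-nonmember p {b} eq =
  (λ { refl → not-¬ (update-here p b) eq }) ,
  trans (sym (update-there p λ { refl → not-¬ (update-here p b) eq })) eq

LooplessShift : ∀ {n} → Digraph n → Fin n → Fin n → Set
LooplessShift {n} E i j = Σ (Digraph n) λ E′ → Loopless E′ × InShift E E′ i j

shift-by-redirect : ∀ {n} {E : Digraph n} {u i j} → Loopless E →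
                    E u i ≡ true → E u j ≡ false → u ≢ j → LooplessShift E i j
shift-by-redirect {E = E} {u} {i} {j} loopless ui uj u≢j =
  redirect E u i j , redirect-loopless loopless u≢j , redirect-shift E ui uj

-- The witnesses are found by the pigeonhole principle on (closed) neighbourhoods.
shift-in-degree : ∀ {n} (E : Digraph n) {i j} → Loopless E → suc (inn E j) ≤ inn E i →
                  suc (inn E j) < inn E i ⊎ out E j ≤ out E i → LooplessShift E i j
shift-in-degree {n} E {i} {j} loopless j<i alternative with E j i in ji | E i j in ij
... | false | _ = switch (pigeonhole (λ v → E v i) (λ v → E v j) j<i)
  where
  -- an in-neighbour u of i that is not one of j; u ≠ j as j ↛ i
  switch : ∃[ u ] E u i ≡ true × E u j ≡ false → LooplessShift E i j
  switch (u , ui , uj) = shift-by-redirect loopless ui uj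
    (λ u≡j → not-¬ (trans (sym (cong (λ v → E v i) u≡j)) ui) ji)
... | true | true = switch (pigeonhole N⁻[i] N⁻[j] larger)
  where
  -- compare the closed in-neighbourhoods; the witness is not i, as i → j
  N⁻[i] N⁻[j] : Fin n → Bool
  N⁻[i] = (λ v → E v i) [ i ≔ true ]
  N⁻[j] = (λ v → E v j) [ j ≔ true ]
  larger : count N⁻[j] < count N⁻[i]
  larger = subst₂ _<_ (sym (count-insert _ j (loopless j))) (sym (count-insert _ i (loopless i))) (s≤s j<i)
  switch : ∃[ u ] N⁻[i] u ≡ true × N⁻[j] u ≡ false → LooplessShift E i j
  switch (u , ui , uj) with insert-nonmember (λ v → E v j) uj
  ... | u≢j , uj′ = shift-by-redirect loopless (insert-member (λ v → E v i) ui u≢i) uj′ u≢j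
    where
    u≢i : u ≢ i
    u≢i u≡i = not-¬ (trans (cong (λ v → E v j) u≡i) ij) uj′
... | true | false with alternative
...   | inj₁ j≪i = switch (pigeonhole (λ v → E v i) N⁻[j] larger)
  where
  -- compare the in-neighbourhood of i with the closed one of j
  N⁻[j] : Fin n → Bool
  N⁻[j] = (λ v → E v j) [ j ≔ true ]
  larger : count N⁻[j] < inn E i
  larger = subst (_< inn E i) (sym (count-insert _ j (loopless j))) j≪i
  switch : ∃[ u ] E u i ≡ true × N⁻[j] u ≡ false → LooplessShift E i j
  switch (u , ui , uj) with insert-nonmember (λ v → E v j) uj
  ... | u≢j , uj′ = shift-by-redirect loopless ui uj′ u≢j
...   | inj₂ outj≤outi = switch (pigeonhole N⁺[i] (E j) larger)
  where
  -- An out-neighbour w of i outside N⁺(j) allows the switch j→i, i→w ⇝ j→w, i→j,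
  -- performed as two redirections: of j→i to w, then of i→w to j.
  N⁺[i] : Fin n → Bool
  N⁺[i] = E i [ i ≔ true ]
  larger : out E j < count N⁺[i]
  larger = subst (out E j <_) (sym (count-insert (E i) i (loopless i))) (s≤s outj≤outi)
  i≢j : i ≢ j
  i≢j refl = 1+n≰n j<i
  switch : ∃[ w ] N⁺[i] w ≡ true × E j w ≡ false → LooplessShift E i j
  switch (w , iw , jw) = E₂ , redirect-loopless loopless₁ i≢j ,
                         InShift-trans (redirect-shift E ji jw) (redirect-shift E₁ iw₁ ij₁)
    where
    w≢i : w ≢ i
    w≢i w≡i = not-¬ (trans (cong (E j) w≡i) ji) jw
    iw′ : E i w ≡ true
    iw′ = insert-member (E i) iw w≢i
    j≢w : j ≢ w
    j≢w j≡w = not-¬ (trans (cong (E i) j≡w) iw′) ij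
    E₁ E₂ : Digraph n
    E₁ = redirect E j i w
    E₂ = redirect E₁ i w j
    loopless₁ : Loopless E₁
    loopless₁ = redirect-loopless loopless j≢w
    -- the first redirection leaves the row of i untouched
    row-i : E₁ i ≡ E i
    row-i = update-there E i≢j
    iw₁ : E₁ i w ≡ true
    iw₁ = trans (cong (λ r → r w) row-i) iw′
    ij₁ : E₁ i j ≡ false
    ij₁ = trans (cong (λ r → r j) row-i) ij

if-+ : ∀ (b : Bool) x y → (if b then Int.+ x else Int.+ y) ≡ Int.+ (if b then x else y)
if-+ true  x y = refl
if-+ false x y = refl

lowered⇔ : ∀ (b : Bool) a x → ((if b then Int.+ a Int.- Int.+ 1 else Int.+ a) ≡ Int.+ x) ⇔ (a ≡ ind b + x)
lowered⇔ false a       x = mk⇔ +ℤ-injective (cong (λ n → Int.+ n))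
lowered⇔ true  zero    x = mk⇔ (λ ()) (λ ())
lowered⇔ true  (suc a) x = mk⇔ (cong suc ∘ +ℤ-injective) (λ eq → cong (λ n → Int.+ n) (suc-injective eq))

module Reduction {m : ℕ} (d⁺ d⁻ : Fin (suc m) → ℕ) where

  -- Out-degrees demanded by a reduced sequence: the last vertex has spent its out-edges.
  reducedOut : Fin (suc m) → ℕ
  reducedOut k = if toℕ k ≡ᵇ m then 0 else d⁺ k

  reducedOut-inner : ∀ k → toℕ k < m → reducedOut k ≡ d⁺ k
  reducedOut-inner k k<m with toℕ k ≡ᵇ m in last
  ... | false = refl
  ... | true  = ⊥-elim (<⇒≢ k<m (≡ᵇ⇒≡ (toℕ k) m (Equivalence.from T-≡ last)))

  -- E realizes the B-reduced sequence, with its vertices of degree (0,0) kept.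
  Realizes : (Fin (suc m) → Bool) → Digraph (suc m) → Set
  Realizes B E = Loopless E × (∀ k → out E k ≡ reducedOut k) × (∀ k → d⁻ k ≡ ind (B k) + inn E k)

  reducedEntry : (Fin (suc m) → Bool) → Fin (suc m) → ℤ × ℤ
  reducedEntry B k = (if toℕ k ≡ᵇ m then Int.+ 0 else Int.+ d⁺ k)
                   , (if B k then Int.+ d⁻ k Int.- Int.+ 1 else Int.+ d⁻ k)

  realizable⇔realizes : ∀ B → Realizable (reducedEntry B) ⇔ Σ (Digraph (suc m)) (Realizes B)
  realizable⇔realizes B = mk⇔
    (λ (E , loopless , realizes) → E , loopless ,
       (λ k → +ℤ-injective (trans (sym (cong proj₁ (realizes k))) (if-+ (toℕ k ≡ᵇ m) 0 (d⁺ k)))) ,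
       (λ k → Equivalence.to (lowered⇔ (B k) (d⁻ k) (inn E k)) (cong proj₂ (realizes k))))
    (λ (E , loopless , outs , ins) → E , loopless , λ k →
       cong₂ _,_ (trans (if-+ (toℕ k ≡ᵇ m) 0 (d⁺ k)) (cong (λ n → Int.+ n) (sym (outs k))))
                 (Equivalence.from (lowered⇔ (B k) (d⁻ k) (inn E k)) (ins k)))

  reduced⇔realizes : ∀ B → BiGraphical (reduced d⁺ d⁻ B) ⇔ Σ (Digraph (suc m)) (Realizes B)
  reduced⇔realizes B =
    realizable⇔realizes B ⇔-∘ (tabulate-realizable (reducedEntry B) ⇔-∘
    (dropZeros-realizable (tabulate (reducedEntry B)) ⇔-∘
    (biGraphical⇔realizable (dropZeros (tabulate (reducedEntry B))) ⇔-∘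
    mk⇔ (subst BiGraphical unfold) (subst BiGraphical (sym unfold)))))
    where
    unfold : reduced d⁺ d⁻ B ≡ dropZeros (tabulate (reducedEntry B))
    unfold = cong dropZeros (map-tabulate id (reducedEntry B))

  realizes-cong : ∀ {B B′ E} → (∀ k → B k ≡ B′ k) → Realizes B E → Realizes B′ E
  realizes-cong {E = E} B≗B′ (loopless , outs , ins) =
    loopless , outs , λ k → trans (ins k) (cong (λ b → ind b + inn E k) (B≗B′ k))

  _⊒_ : Fin (suc m) → Fin (suc m) → Set
  i ⊒ j = (d⁻ i > d⁻ j) ⊎ ((d⁻ i ≡ d⁻ j) × (d⁺ i ≥ d⁺ j))

  ⊒⇒≥ : ∀ {i j} → i ⊒ j → d⁻ j ≤ d⁻ i
  ⊒⇒≥ (inj₁ i>j)      = <⇒≤ i>j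
  ⊒⇒≥ (inj₂ (i≡j , _)) = ≤-reflexive (sym i≡j)

  ⊒-trans : ∀ {i j k} → i ⊒ j → j ⊒ k → i ⊒ k
  ⊒-trans {i}     (inj₁ i>j)         (inj₁ j>k)         = inj₁ (<-trans j>k i>j)
  ⊒-trans {i}     (inj₁ i>j)         (inj₂ (j≡k , _))   = inj₁ (subst (_< d⁻ i) j≡k i>j)
  ⊒-trans {k = k} (inj₂ (i≡j , _))   (inj₁ j>k)         = inj₁ (subst (d⁻ k <_) (sym i≡j) j>k)
  ⊒-trans         (inj₂ (i≡j , i≥j)) (inj₂ (j≡k , j≥k)) = inj₂ (trans i≡j j≡k , ≤-trans j≥k i≥j)

  ⊒-chain : ∀ bound → (∀ i j → toℕ j ≡ suc (toℕ i) → toℕ j < bound → i ⊒ j) →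
            ∀ i j → toℕ i < toℕ j → toℕ j < bound → i ⊒ j
  ⊒-chain bound consecutive i j i<j = chain (toℕ j ∸ suc (toℕ i)) i j gap
    where
    gap : toℕ j ≡ suc (toℕ j ∸ suc (toℕ i) + toℕ i)
    gap = trans (sym (m∸n+n≡m i<j)) (+-suc _ (toℕ i))
    -- induction on the number g of vertices strictly between i and j
    chain : ∀ g i j → toℕ j ≡ suc (g + toℕ i) → toℕ j < bound → i ⊒ j
    chain zero    i j j≡1+i j<bound = consecutive i j j≡1+i j<bound
    chain (suc g) i j j≡2+g+i j<bound =
      ⊒-trans (chain g i k (toℕ-fromℕ< k<1+m) (<-trans k<j j<bound))
              (consecutive k j (trans j≡2+g+i (cong suc (sym (toℕ-fromℕ< k<1+m)))) j<bound)
      where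
      1+g+i<j : suc (g + toℕ i) < toℕ j
      1+g+i<j = subst (suc (g + toℕ i) <_) (sym j≡2+g+i) (n<1+n _)
      k<1+m : suc (g + toℕ i) < suc m
      k<1+m = <-trans 1+g+i<j (toℕ<n j)
      k : Fin (suc m)
      k = fromℕ< k<1+m
      k<j : toℕ k < toℕ j
      k<j = subst (_< toℕ j) (sym (toℕ-fromℕ< k<1+m)) 1+g+i<j

  -- Exchange step: exchanging j ∈ B for i ∉ B with i ⊒ j preserves realizability,
  -- by moving one unit of in-degree from i to j in the realizing digraph.
  realizes-exchange : ∀ {B E i j} → B i ≡ false → B j ≡ true → toℕ i < m → toℕ j < m → i ⊒ j →
                      Realizes B E → Σ (Digraph (suc m)) (Realizes (exchange B i j))
  realizes-exchange {B} {E} {i} {j} Bi Bj i<m j<m i⊒j (loopless , outs , ins) =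
    conclude (shift-in-degree E loopless in-gap alternative)
    where
    inn-i : inn E i ≡ d⁻ i
    inn-i = sym (trans (ins i) (cong (λ b → ind b + inn E i) Bi))
    inn-j : suc (inn E j) ≡ d⁻ j
    inn-j = sym (trans (ins j) (cong (λ b → ind b + inn E j) Bj))
    out-i : out E i ≡ d⁺ i
    out-i = trans (outs i) (reducedOut-inner i i<m)
    out-j : out E j ≡ d⁺ j
    out-j = trans (outs j) (reducedOut-inner j j<m)
    in-gap : suc (inn E j) ≤ inn E i
    in-gap = subst₂ _≤_ (sym inn-j) (sym inn-i) (⊒⇒≥ i⊒j)
    alternative : suc (inn E j) < inn E i ⊎ out E j ≤ out E i
    alternative = Sum.map (subst₂ _<_ (sym inn-j) (sym inn-i))
                          (λ (_ , i≥j) → subst₂ _≤_ (sym out-j) (sym out-i) i≥j) i⊒j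
    conclude : LooplessShift E i j → Σ (Digraph (suc m)) (Realizes (exchange B i j))
    conclude (E′ , loopless′ , outs′ , ins′) =
      E′ , loopless′ , (λ k → trans (outs′ k) (outs k)) ,
      λ k → trans (ins k) (sym (balance {c = ind (exchange B i j k)} {d = ind (B k)}
                                          (shifted k) (exchange-balance B Bi Bj k)))
      where
      shifted : ∀ k → inn E′ k + δ i k ≡ inn E k + δ j k
      shifted k = trans (+-comm (inn E′ k) (δ i k)) (trans (ins′ k) (+-comm (δ j k) (inn E k)))

  -- Parameters: f forbidden vertices {v_{n-f}, …, v_{n-1}}, the F-normal order on
  -- consecutive allowed vertices, and the target size d.
  module Convergence (f d : ℕ) (normal : ∀ i j → toℕ j ≡ suc (toℕ i) → toℕ j < m ∸ f → i ⊒ j) where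

    F : Fin (suc m) → Bool
    F = firstSet d

    mismatch-sym : ∀ B → count B ≡ d → count (F ∖ B) ≡ count (B ∖ F)
    mismatch-sym B |B| = sym (count-∖-balance B F (trans |B| (sym |F|)))
      where
      |F| : count F ≡ d
      |F| = count-initial (suc m) d (subst (_≤ suc m) |B| (count≤size B))

    -- Induction on r = |B ∖ F|: while B ≠ F, exchange some j ∈ B ∖ F for some i ∈ F ∖ B.
    -- Then i < d ≤ j < m - f, so i ⊒ j by the normal order.
    realizes-first : ∀ r B → count (B ∖ F) ≡ r → count B ≡ d →
                     (∀ k → B k ≡ true → toℕ k < m ∸ f) →
                     Σ (Digraph (suc m)) (Realizes B) → Σ (Digraph (suc m)) (Realizes F)
    realizes-first zero B no-mismatch |B| _ (E , realizes) = E , realizes-cong {E = E} B≗F realizes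
      where
      B≗F : ∀ k → B k ≡ F k
      B≗F k = ∖-empty⇒≡ B F (count≡0⇒empty (B ∖ F) no-mismatch k)
                             (count≡0⇒empty (F ∖ B) (trans (mismatch-sym B |B|) no-mismatch) k)
    realizes-first (suc r) B mismatch |B| B-bound (E , realizes) =
      exchange-step (count>0⇒element (F ∖ B) (positive (trans (mismatch-sym B |B|) mismatch)))
                    (count>0⇒element (B ∖ F) (positive mismatch))
      where
      positive : ∀ {x} → x ≡ suc r → 0 < x
      positive refl = s≤s z≤n
      exchange-step : ∃[ i ] (F ∖ B) i ≡ true → ∃[ j ] (B ∖ F) j ≡ true → Σ (Digraph (suc m)) (Realizes F)
      exchange-step (i , i∈F∖B) (j , j∈B∖F) with ∖-member F B i∈F∖B | ∖-member B F j∈B∖F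
      ... | Fi , Bi | Bj , Fj =
        realizes-first r (exchange B i j) mismatch′ (trans (exchange-count B Bi Bj) |B|)
          (exchange-bounded B Bi Bj (λ k → toℕ k < m ∸ f) (<-trans i<j j<bound) B-bound)
          (realizes-exchange {E = E} Bi Bj (<-trans i<j j<m) j<m (⊒-chain (m ∸ f) normal i j i<j j<bound) realizes)
        where
        i<d : toℕ i < d
        i<d = <ᵇ⇒< (toℕ i) d (Equivalence.from T-≡ Fi)
        d≤j : d ≤ toℕ j
        d≤j = ≮⇒≥ (λ j<d → not-¬ (Equivalence.to T-≡ (<⇒<ᵇ j<d)) Fj)
        i<j : toℕ i < toℕ j
        i<j = <-≤-trans i<d d≤j
        j<bound : toℕ j < m ∸ f
        j<bound = B-bound j Bj
        j<m : toℕ j < m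
        j<m = <-≤-trans j<bound (m∸n≤m m f)
        mismatch′ : count (exchange B i j ∖ F) ≡ r
        mismatch′ = +-cancelʳ-≡ 1 _ r (trans (exchange-mismatch B Bi Bj F Fi Fj) (trans mismatch (+-comm 1 r)))

∣∣≡count : ∀ {n} (A : Subset n) → ∣ A ∣ ≡ count (lookup A)
∣∣≡count []          = refl
∣∣≡count (true ∷ A)  = cong suc (∣∣≡count A)
∣∣≡count (false ∷ A) = ∣∣≡count A

theorem4 : (m f : ℕ) (d⁺ d⁻ : Fin (suc m) → ℕ) →
    f ≤ m →
    ((i j : Fin (suc m)) → toℕ j ≡ suc (toℕ i) → toℕ j < m ∸ f →
       (d⁻ i > d⁻ j) ⊎ ((d⁻ i ≡ d⁻ j) × (d⁺ i ≥ d⁺ j))) →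
    (A : Subset (suc m)) →
    ∣ A ∣ ≡ d⁺ (fromℕ m) →
    ((k : Fin (suc m)) → k ∈ A → toℕ k < m ∸ f) →
    BiGraphical (reduced d⁺ d⁻ (lookup A)) →
    BiGraphical (reduced d⁺ d⁻ (firstSet (d⁺ (fromℕ m))))
theorem4 m f d⁺ d⁻ _ normal A |A| A-avoids-forbidden A-graphical =
  Equivalence.from (reduced⇔realizes F)
    (realizes-first _ (lookup A) refl (trans (sym (∣∣≡count A)) |A|) A-bounded
      (Equivalence.to (reduced⇔realizes (lookup A)) A-graphical))
  where
  open Reduction d⁺ d⁻
  open Convergence f (d⁺ (fromℕ m)) normal
  A-bounded : ∀ k → lookup A k ≡ true → toℕ k < m ∸ f
  A-bounded k k∈A = A-avoids-forbidden k (lookup⇒[]= k A k∈A)
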